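{- Let $\ell$ be any logic proving every instance of $\mathbf{I}A\land\Diamond\top\to\Diamond A$, let $\Phi$ be a finite adequate set, and let $\Gamma,\Delta\in K_\ell$. If $\mathbf{I}C\in\Gamma$ and $\Gamma\prec\Delta$, then there exists $\Theta\in K_\ell$ such that $\Gamma\prec\Theta$ and $C\in\Theta$.
   Context: $\mathcal{L}(\Box,\mathbf{I})$-formulas are built from propositional variables and $\bot$ by $\to$ and unary modal operators $\Box$, $\mathbf{I}$; $\Diamond A:\equiv\neg\Box\neg A$. The logic $\mathbf{il}^-$ has as axioms all tautologies, $\Box(A\to B)\to(\Box A\to\Box B)$, $\Box(\Box A\to A)\to\Box A$, $\Box\bot\leftrightarrow\mathbf{I}\bot$; rules: Modus Ponens, Necessitation, and from $A\to B$ infer $\mathbf{I}A\to\mathbf{I}B$. Throughout, "logic" $\ell$ means a set of $\mathcal{L}(\Box,\mathbf{I})$-formulas containing $\mathbf{il}^-$ and closed under its rules. ${\sim}A$ is $B$ if $A$ is of the form $\neg B$, and $\neg A$ otherwise. For a set $\Phi$ of formulas, $\Phi_{\mathbf{I}}:=\{C:\mathbf{I}C\in\Phi\}$. $\Phi$ is adequate if it is closed under subformulas and ${\sim}$, $\bot\in\Phi_{\mathbf{I}}$, and whenever $C,E\in\Phi_{\mathbf{I}}$ then $\Box C,\Box(C\lor\Diamond C),\Box(E\to\Diamond C),\Box(E\to C),\Box(E\to C\lor\Diamond C)\in\Phi$. A finite set $X$ is $\ell$-consistent if $\ell\nvdash\bigwedge X\to\bot$. $\Gamma\subseteq\Phi$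 is $\Phi$-maximally $\ell$-consistent if it is $\ell$-consistent and for each $A\in\Phi$, $A\in\Gamma$ or ${\sim}A\in\Gamma$. $K_\ell$ is the set of all $\Phi$-maximally $\ell$-consistent sets. For $\Gamma,\Delta\in K_\ell$: $\Gamma\prec\Delta$ iff $\{B,\Box B:\Box B\in\Gamma\}\subseteq\Delta$ and there is $\Box C\in\Delta$ with $\Box C\notin\Gamma$. -}

module Defs where

open import Data.Nat using (ℕ)
open import Data.Bool using (Bool; true; false; _∧_; _∨_; not)
open import Data.List using (List; foldr)
open import Data.List.Membership.Propositional using (_∈_)
open import Data.Product using (Σ; _×_; ∃-syntax)
open import Data.Sum using (_⊎_)
open import Relation.Nullary using (¬_)
open import Relation.Binary.PropositionalEquality using (_≡_)

infixr 5 _⇒_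

data Fm : Set where
  var : ℕ → Fm
  ⊥'  : Fm
  _⇒_ : Fm → Fm → Fm
  □   : Fm → Fm
  I   : Fm → Fm

¬' : Fm → Fm
¬' A = A ⇒ ⊥'

⊤' : Fm
⊤' = ¬' ⊥'

_∧'_ : Fm → Fm → Fm
A ∧' B = ¬' (A ⇒ ¬' B)

_∨'_ : Fm → Fm → Fm
A ∨' B = ¬' A ⇒ B

_⇔_ : Fm → Fm → Fm
A ⇔ B = (A ⇒ B) ∧' (B ⇒ A)

◇ : Fm → Fm
◇ A = ¬' (□ (¬' A))

~ : Fm → Fm
~ (B ⇒ ⊥') = B
~ A = ¬' A

eval : (Fm → Bool) → Fm → Bool
eval v (var n) = v (var n)
eval v ⊥' = false
eval v (A ⇒ B) = not (eval v A) ∨ eval v B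
eval v (□ A) = v (□ A)
eval v (I A) = v (I A)

Tautology : Fm → Set
Tautology A = (v : Fm → Bool) → eval v A ≡ true

-- ℓ (a set of formulas, as a predicate) contains il⁻ and is closed under its rules
record IsLogic (ℓ : Fm → Set) : Set where
  field
    taut : ∀ A → Tautology A → ℓ A
    axK  : ∀ A B → ℓ (□ (A ⇒ B) ⇒ (□ A ⇒ □ B))
    axL  : ∀ A → ℓ (□ (□ A ⇒ A) ⇒ □ A)
    axI  : ℓ (□ ⊥' ⇔ I ⊥')
    mp   : ∀ A B → ℓ (A ⇒ B) → ℓ A → ℓ B
    nec  : ∀ A → ℓ A → ℓ (□ A)
    ruleI : ∀ A B → ℓ (A ⇒ B) → ℓ (I A ⇒ I B)

⋀ : List Fm → Fm
⋀ = foldr _∧'_ ⊤'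

Consistent : (Fm → Set) → List Fm → Set
Consistent ℓ X = ¬ ℓ (⋀ X ⇒ ⊥')

_∈I_ : Fm → List Fm → Set
C ∈I Φ = I C ∈ Φ

record Adequate (Φ : List Fm) : Set where
  field
    sub⇒ˡ : ∀ A B → (A ⇒ B) ∈ Φ → A ∈ Φ
    sub⇒ʳ : ∀ A B → (A ⇒ B) ∈ Φ → B ∈ Φ
    sub□  : ∀ A → □ A ∈ Φ → A ∈ Φ
    subI  : ∀ A → I A ∈ Φ → A ∈ Φ
    clos~ : ∀ A → A ∈ Φ → ~ A ∈ Φ
    ⊥∈I   : ⊥' ∈I Φ
    c1 : ∀ C → C ∈I Φ → □ C ∈ Φ
    c2 : ∀ C → C ∈I Φ → □ (C ∨' ◇ C) ∈ Φ
    c3 : ∀ C E → C ∈I Φ → E ∈I Φ → □ (E ⇒ ◇ C) ∈ Φ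
    c4 : ∀ C E → C ∈I Φ → E ∈I Φ → □ (E ⇒ C) ∈ Φ
    c5 : ∀ C E → C ∈I Φ → E ∈I Φ → □ (E ⇒ (C ∨' ◇ C)) ∈ Φ

record K (ℓ : Fm → Set) (Φ : List Fm) (Γ : List Fm) : Set where
  field
    ⊆Φ   : ∀ A → A ∈ Γ → A ∈ Φ
    cons : Consistent ℓ Γ
    max  : ∀ A → A ∈ Φ → A ∈ Γ ⊎ ~ A ∈ Γ

_≺_ : List Fm → List Fm → Set
Γ ≺ Δ = (∀ B → □ B ∈ Γ → B ∈ Δ × □ B ∈ Δ)
      × (∃[ C ] (□ C ∈ Δ × ¬ (□ C ∈ Γ)))

-- From Γ ≺ Δ we get some □D ∈ Δ outside Γ, so ¬□D ∈ Γ and hence ◇⊤ is derivable from Γ;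
-- with IC ∈ Γ the axiom IA ∧ ◇⊤ → ◇A makes ◇C derivable from Γ. The set
-- {C, □¬C} ∪ {B, □B : □B ∈ Γ} is then consistent: otherwise Γ would derive □(□¬C → ¬C)
-- (using □B → □□B), hence □¬C by Löb's axiom, contradicting ◇C. Any Φ-maximal extension Θ
-- of it is a ≺-successor of Γ containing C, with □¬C witnessing strictness.
module Submission where

open import Defs
open import Level using (0ℓ)
open import Axiom.ExcludedMiddle using (ExcludedMiddle)
open import Data.Bool using (Bool; true; false; _∧_; _∨_; not)
open import Data.Empty using (⊥-elim)
open import Data.List using (List; []; _∷_; concatMap)
open import Data.List.Membership.Propositional using (_∈_; find; lose)
open import Data.List.Membership.Propositional.Properties using (∈-concatMap⁺; ∈-concatMap⁻)
open import Data.List.Relation.Binary.Subset.Propositional using (_⊆_)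
open import Data.List.Relation.Unary.Any using (here; there)
open import Data.Product using (_×_; _,_; ∃-syntax)
open import Data.Sum using (_⊎_; inj₁; inj₂)
open import Relation.Nullary using (¬_; yes; no)
open import Relation.Binary.PropositionalEquality using (_≡_; refl; subst; sym)

private
  variable
    A B D P : Fm
    X Γ Δ Ψ : List Fm

infixr 5 _⊃_

-- Boolean implication, in exactly the shape `eval` computes for _⇒_.
_⊃_ : Bool → Bool → Bool
a ⊃ b = not a ∨ b

everywhere₁ : (Bool → Bool) → Bool
everywhere₁ f = f true ∧ f false

everywhere₂ : (Bool → Bool → Bool) → Bool
everywhere₂ f = everywhere₁ λ a → everywhere₁ (f a)

everywhere₃ : (Bool → Bool → Bool → Bool) → Bool
everywhere₃ f = everywhere₁ λ a → everywhere₂ (f a)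

everywhere₁-sound : ∀ f → everywhere₁ f ≡ true → ∀ a → f a ≡ true
everywhere₁-sound f h true with f true
... | true = refl
everywhere₁-sound f h false with f true
... | true = h

everywhere₂-sound : ∀ f → everywhere₂ f ≡ true → ∀ a b → f a b ≡ true
everywhere₂-sound f h a = everywhere₁-sound (f a) (everywhere₁-sound (λ a → everywhere₁ (f a)) h a)

everywhere₃-sound : ∀ f → everywhere₃ f ≡ true → ∀ a b c → f a b c ≡ true
everywhere₃-sound f h a = everywhere₂-sound (f a) (everywhere₁-sound (λ a → everywhere₂ (f a)) h a)

eval-~ : ∀ v A → eval v (~ A) ≡ (eval v A ⊃ false)
eval-~ v (var _) = refl
eval-~ v ⊥' = refl
eval-~ v (A ⇒ var _) = refl
eval-~ v (A ⇒ ⊥') with eval v A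
... | true = refl
... | false = refl
eval-~ v (A ⇒ (_ ⇒ _)) = refl
eval-~ v (A ⇒ □ _) = refl
eval-~ v (A ⇒ I _) = refl
eval-~ v (□ _) = refl
eval-~ v (I _) = refl

module Derivations {ℓ : Fm → Set} (L : IsLogic ℓ) where
  open IsLogic L

  mp₂ : ℓ (A ⇒ B ⇒ D) → ℓ A → ℓ B → ℓ D
  mp₂ h a b = mp _ _ (mp _ _ h a) b

  ⇒-trans : ℓ (A ⇒ B) → ℓ (B ⇒ D) → ℓ (A ⇒ D)
  ⇒-trans {A} {B} {D} = mp₂ (taut _ λ v →
    everywhere₃-sound (λ a b d → (a ⊃ b) ⊃ (b ⊃ d) ⊃ (a ⊃ d)) refl (eval v A) (eval v B) (eval v D))

  ⇒-distrib : ℓ (P ⇒ A ⇒ B) → ℓ (P ⇒ A) → ℓ (P ⇒ B)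
  ⇒-distrib {P} {A} {B} = mp₂ (taut _ λ v →
    everywhere₃-sound (λ p a b → (p ⊃ a ⊃ b) ⊃ (p ⊃ a) ⊃ (p ⊃ b)) refl (eval v P) (eval v A) (eval v B))

  ⇒-combine : ℓ (P ⇒ A) → ℓ (P ⇒ B) → ℓ (A ⇒ B ⇒ D) → ℓ (P ⇒ D)
  ⇒-combine pa pb abd = ⇒-distrib (⇒-trans pa abd) pb

  ⇒-absurd : ℓ (P ⇒ A) → ℓ (P ⇒ ¬' A) → ℓ (P ⇒ ⊥')
  ⇒-absurd {P} {A} pa pna = ⇒-combine pa pna (taut _ λ v →
    everywhere₁-sound (λ a → a ⊃ (a ⊃ false) ⊃ false) refl (eval v A))

  ⇒-const : ℓ B → ℓ (A ⇒ B)
  ⇒-const {B} {A} = mp _ _ (taut _ λ v →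
    everywhere₂-sound (λ b a → b ⊃ a ⊃ b) refl (eval v B) (eval v A))

  ∧-intro : ℓ (A ⇒ B ⇒ A ∧' B)
  ∧-intro {A} {B} = taut _ λ v →
    everywhere₂-sound (λ a b → a ⊃ b ⊃ ((a ⊃ b ⊃ false) ⊃ false)) refl (eval v A) (eval v B)

  ∧-elimˡ : ℓ (A ∧' B ⇒ A)
  ∧-elimˡ {A} {B} = taut _ λ v →
    everywhere₂-sound (λ a b → ((a ⊃ b ⊃ false) ⊃ false) ⊃ a) refl (eval v A) (eval v B)

  ∧-elimʳ : ℓ (A ∧' B ⇒ B)
  ∧-elimʳ {A} {B} = taut _ λ v →
    everywhere₂-sound (λ a b → ((a ⊃ b ⊃ false) ⊃ false) ⊃ b) refl (eval v A) (eval v B)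

  contraposition : ℓ (A ⇒ B) → ℓ (¬' B ⇒ ¬' A)
  contraposition {A} {B} = mp _ _ (taut _ λ v →
    everywhere₂-sound (λ a b → (a ⊃ b) ⊃ (b ⊃ false) ⊃ (a ⊃ false)) refl (eval v A) (eval v B))

  ¬⇒~ : ℓ (¬' A ⇒ ~ A)
  ¬⇒~ {A} = taut _ λ v → subst (λ b → (eval v A ⊃ false) ⊃ b ≡ true) (sym (eval-~ v A))
    (everywhere₁-sound (λ a → (a ⊃ false) ⊃ (a ⊃ false)) refl (eval v A))

  □-mono : ℓ (A ⇒ B) → ℓ (□ A ⇒ □ B)
  □-mono {A} {B} h = mp _ _ (axK A B) (nec _ h)

  □-∧ : ℓ (□ A ⇒ □ B ⇒ □ (A ∧' B))
  □-∧ {A} {B} = ⇒-trans (□-mono ∧-intro) (axK B (A ∧' B))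

  ¬□⇒◇⊤ : ℓ (¬' (□ A) ⇒ ◇ ⊤')
  ¬□⇒◇⊤ {A} = contraposition (□-mono (taut _ λ v →
    everywhere₁-sound (λ a → ((false ⊃ false) ⊃ false) ⊃ a) refl (eval v A)))

  -- Löb's axiom applied to B ∧ □B.
  □⇒□□ : ℓ (□ B ⇒ □ (□ B))
  □⇒□□ {B} = ⇒-trans (⇒-trans (□-mono B⇒□⇒) (axL (B ∧' □ B))) (□-mono ∧-elimʳ)
    where
    B⇒□⇒ : ℓ (B ⇒ □ (B ∧' □ B) ⇒ B ∧' □ B)
    B⇒□⇒ = mp _ _ (taut _ λ v → everywhere₃-sound
      (λ b q r → (q ⊃ r) ⊃ b ⊃ q ⊃ ((b ⊃ r ⊃ false) ⊃ false)) refl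
      (eval v B) (eval v (□ (B ∧' □ B))) (eval v (□ B))) (□-mono ∧-elimˡ)

  ∧-curryʳ : ℓ (A ∧' B ⇒ D) → ℓ (B ⇒ A ⇒ D)
  ∧-curryʳ {A} {B} {D} = mp _ _ (taut _ λ v → everywhere₃-sound
    (λ a b d → (((a ⊃ b ⊃ false) ⊃ false) ⊃ d) ⊃ b ⊃ a ⊃ d) refl (eval v A) (eval v B) (eval v D))

  ¬-intro : ℓ (⋀ (A ∷ X) ⇒ ⊥') → ℓ (⋀ X ⇒ ¬' A)
  ¬-intro {A} {X} = mp _ _ (taut _ λ v → everywhere₂-sound
    (λ a x → (((a ⊃ x ⊃ false) ⊃ false) ⊃ false) ⊃ x ⊃ (a ⊃ false)) refl (eval v A) (eval v (⋀ X)))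

  ⋀-elim : A ∈ X → ℓ (⋀ X ⇒ A)
  ⋀-elim (here refl) = ∧-elimˡ
  ⋀-elim (there A∈X) = ⇒-trans ∧-elimʳ (⋀-elim A∈X)

  □⋀-intro : (∀ A → A ∈ X → ℓ (P ⇒ □ A)) → ℓ (P ⇒ □ (⋀ X))
  □⋀-intro {[]} h = ⇒-const (nec _ (taut _ λ v → refl))
  □⋀-intro {A ∷ X} h = ⇒-combine (h A (here refl)) (□⋀-intro λ B m → h B (there m)) □-∧

unbox₁ : Fm → List Fm
unbox₁ (□ B) = B ∷ □ B ∷ []
unbox₁ _ = []

unbox : List Fm → List Fm
unbox = concatMap unbox₁

∈-unbox⁺ : □ B ∈ Γ → B ∈ unbox Γ × □ B ∈ unbox Γ
∈-unbox⁺ □B∈Γ =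
  ∈-concatMap⁺ unbox₁ (lose □B∈Γ (here refl)) , ∈-concatMap⁺ unbox₁ (lose □B∈Γ (there (here refl)))

∈-unbox⁻ : A ∈ unbox Γ → ∃[ B ] (□ B ∈ Γ × (A ≡ B ⊎ A ≡ □ B))
∈-unbox⁻ A∈ with find (∈-concatMap⁻ unbox₁ A∈)
... | □ B , □B∈Γ , here refl = B , □B∈Γ , inj₁ refl
... | □ B , □B∈Γ , there (here refl) = B , □B∈Γ , inj₂ refl

unbox-⊆ : Γ ⊆ Ψ → (∀ B → □ B ∈ Ψ → B ∈ Ψ) → unbox Γ ⊆ Ψ
unbox-⊆ Γ⊆Ψ □-closed A∈ with ∈-unbox⁻ A∈
... | B , □B∈Γ , inj₁ refl = □-closed B (Γ⊆Ψ □B∈Γ)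
... | B , □B∈Γ , inj₂ refl = Γ⊆Ψ □B∈Γ

unbox-⊆⇒inherits-□ : unbox Γ ⊆ Δ → ∀ B → □ B ∈ Γ → B ∈ Δ × □ B ∈ Δ
unbox-⊆⇒inherits-□ unbox⊆Δ B □B∈Γ with ∈-unbox⁺ □B∈Γ
... | B∈ , □B∈ = unbox⊆Δ B∈ , unbox⊆Δ □B∈

module Lindenbaum (lem : ExcludedMiddle 0ℓ) {ℓ : Fm → Set} (L : IsLogic ℓ)
                  (Φ : List Fm) (~-closed : ∀ A → A ∈ Φ → ~ A ∈ Φ) where
  open Derivations L

  consistent-cons : Consistent ℓ X → ∃[ A' ] ((A' ≡ A ⊎ A' ≡ ~ A) × Consistent ℓ (A' ∷ X))
  consistent-cons {X} {A} X-cons with lem {ℓ (⋀ (A ∷ X) ⇒ ⊥')}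
  ... | no A∷X-cons = A , inj₁ refl , A∷X-cons
  ... | yes A∷X-incons = ~ A , inj₂ refl , λ ~A∷X-incons →
    X-cons (⇒-absurd (⇒-trans (¬-intro {X = X} A∷X-incons) ¬⇒~) (¬-intro {X = X} ~A∷X-incons))

  choice-∈Φ : B ≡ A ⊎ B ≡ ~ A → A ∈ Φ → B ∈ Φ
  choice-∈Φ (inj₁ refl) A∈Φ = A∈Φ
  choice-∈Φ (inj₂ refl) A∈Φ = ~-closed _ A∈Φ

  choice-decides : B ≡ A ⊎ B ≡ ~ A → B ∈ X → A ∈ X ⊎ ~ A ∈ X
  choice-decides (inj₁ refl) = inj₁
  choice-decides (inj₂ refl) = inj₂

  record Extension (X Ψ : List Fm) : Set where
    field
      Θ : List Fm
      ⊇X : X ⊆ Θ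
      ⊆Φ : Θ ⊆ Φ
      consistent : Consistent ℓ Θ
      decides : ∀ A → A ∈ Ψ → A ∈ Θ ⊎ ~ A ∈ Θ

  extend : ∀ Ψ → Consistent ℓ X → X ⊆ Φ → Ψ ⊆ Φ → Extension X Ψ
  extend {X} [] X-cons X⊆Φ _ = record
    { Θ = X ; ⊇X = λ m → m ; ⊆Φ = X⊆Φ ; consistent = X-cons ; decides = λ _ () }
  extend {X} (A ∷ Ψ) X-cons X⊆Φ A∷Ψ⊆Φ with consistent-cons {X} {A} X-cons
  ... | A' , A'-choice , A'∷X-cons = record
    { Θ = Θ ; ⊇X = λ m → ⊇X (there m) ; ⊆Φ = ⊆Φ ; consistent = consistent ; decides = decides' }
    where
    A'∷X⊆Φ : A' ∷ X ⊆ Φ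
    A'∷X⊆Φ (here refl) = choice-∈Φ A'-choice (A∷Ψ⊆Φ (here refl))
    A'∷X⊆Φ (there m) = X⊆Φ m
    open Extension (extend {A' ∷ X} Ψ A'∷X-cons A'∷X⊆Φ (λ m → A∷Ψ⊆Φ (there m)))
    decides' : ∀ B → B ∈ A ∷ Ψ → B ∈ Θ ⊎ ~ B ∈ Θ
    decides' B (here refl) = choice-decides A'-choice (⊇X (here refl))
    decides' B (there m) = decides B m

  lindenbaum : Consistent ℓ X → X ⊆ Φ → ∃[ Θ ] (K ℓ Φ Θ × X ⊆ Θ)
  lindenbaum X-cons X⊆Φ = Θ , record { ⊆Φ = λ _ → ⊆Φ ; cons = consistent ; max = decides } , ⊇X
    where open Extension (extend Φ X-cons X⊆Φ (λ m → m))

module Successors (lem : ExcludedMiddle 0ℓ) {ℓ : Fm → Set} (L : IsLogic ℓ)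
                  {Φ : List Fm} (ad : Adequate Φ) where
  open IsLogic L
  open Derivations L
  open Adequate ad
  open Lindenbaum lem L Φ clos~

  ≺-◇⊤ : K ℓ Φ Γ → K ℓ Φ Δ → Γ ≺ Δ → ℓ (⋀ Γ ⇒ ◇ ⊤')
  ≺-◇⊤ KΓ KΔ (_ , D , □D∈Δ , □D∉Γ) with K.max KΓ (□ D) (K.⊆Φ KΔ _ □D∈Δ)
  ... | inj₁ □D∈Γ = ⊥-elim (□D∉Γ □D∈Γ)
  ... | inj₂ ¬□D∈Γ = ⇒-trans (⋀-elim ¬□D∈Γ) ¬□⇒◇⊤

  ⋀-□-unbox : ℓ (⋀ Γ ⇒ □ (⋀ (unbox Γ)))
  ⋀-□-unbox {Γ} = □⋀-intro λ A A∈ → case (∈-unbox⁻ A∈)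
    where
    case : ∃[ B ] (□ B ∈ Γ × (A ≡ B ⊎ A ≡ □ B)) → ℓ (⋀ Γ ⇒ □ A)
    case (B , □B∈Γ , inj₁ refl) = ⋀-elim □B∈Γ
    case (B , □B∈Γ , inj₂ refl) = ⇒-trans (⋀-elim □B∈Γ) □⇒□□

  ◇-consistent : ℓ (⋀ Γ ⇒ ◇ A) → Consistent ℓ Γ → Consistent ℓ (A ∷ □ (¬' A) ∷ unbox Γ)
  ◇-consistent {Γ} {A} Γ⇒◇A Γ-cons incons = Γ-cons (⇒-absurd Γ⇒□¬A Γ⇒◇A)
    where
    U⇒Löb : ℓ (⋀ (unbox Γ) ⇒ □ (¬' A) ⇒ ¬' A)
    U⇒Löb = ∧-curryʳ (¬-intro {X = □ (¬' A) ∷ unbox Γ} incons)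
    Γ⇒□¬A : ℓ (⋀ Γ ⇒ □ (¬' A))
    Γ⇒□¬A = ⇒-trans (⋀-□-unbox {Γ}) (⇒-trans (□-mono U⇒Löb) (axL (¬' A)))

  ◇-successor : K ℓ Φ Γ → ℓ (⋀ Γ ⇒ ◇ A) → A ∈ Φ → □ (¬' A) ∈ Φ →
                ∃[ Θ ] (K ℓ Φ Θ × Γ ≺ Θ × A ∈ Θ)
  ◇-successor {Γ} {A} KΓ Γ⇒◇A A∈Φ □¬A∈Φ with lindenbaum (◇-consistent {Γ} Γ⇒◇A (K.cons KΓ)) X⊆Φ
    where
    X⊆Φ : A ∷ □ (¬' A) ∷ unbox Γ ⊆ Φ
    X⊆Φ (here refl) = A∈Φ
    X⊆Φ (there (here refl)) = □¬A∈Φ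
    X⊆Φ (there (there m)) = unbox-⊆ (K.⊆Φ KΓ _) sub□ m
  ... | Θ , KΘ , X⊆Θ = Θ , KΘ , (Γ-inherits , ¬' A , X⊆Θ (there (here refl)) , □¬A∉Γ) , X⊆Θ (here refl)
    where
    Γ-inherits : ∀ B → □ B ∈ Γ → B ∈ Θ × □ B ∈ Θ
    Γ-inherits = unbox-⊆⇒inherits-□ (λ m → X⊆Θ (there (there m)))
    □¬A∉Γ : ¬ (□ (¬' A) ∈ Γ)
    □¬A∉Γ □¬A∈Γ = K.cons KΓ (⇒-absurd (⋀-elim □¬A∈Γ) Γ⇒◇A)

lemma4p8 : ExcludedMiddle 0ℓ →
    (ℓ : Fm → Set) → IsLogic ℓ →
    (∀ A → ℓ ((I A ∧' ◇ ⊤') ⇒ ◇ A)) →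
    (Φ : List Fm) → Adequate Φ →
    (Γ Δ : List Fm) → K ℓ Φ Γ → K ℓ Φ Δ →
    (C : Fm) → I C ∈ Γ → Γ ≺ Δ →
    ∃[ Θ ] (K ℓ Φ Θ × Γ ≺ Θ × C ∈ Θ)
lemma4p8 lem ℓ L I∧◇⊤⇒◇ Φ ad Γ Δ KΓ KΔ C IC∈Γ Γ≺Δ =
  ◇-successor KΓ Γ⇒◇C (subI C IC∈Φ) (c4 ⊥' C ⊥∈I IC∈Φ)
  where
  open Derivations L
  open Successors lem L ad
  open Adequate ad
  IC∈Φ : I C ∈ Φ
  IC∈Φ = K.⊆Φ KΓ _ IC∈Γ
  Γ⇒◇C : ℓ (⋀ Γ ⇒ ◇ C)
  Γ⇒◇C = ⇒-trans (⇒-combine (⋀-elim IC∈Γ) (≺-◇⊤ KΓ KΔ Γ≺Δ) ∧-intro) (I∧◇⊤⇒◇ C)
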